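{- Suppose $\mathcal{A}_0 \supseteq \mathcal{A}_1 \supseteq \dots$ is a decreasing sequence of largeness classes. Then $\bigcap_s \mathcal{A}_s$ is a largeness class.
   Context: Subsets of $\omega$ are identified with elements of $2^\omega$. A largeness class is a non-empty collection $\mathcal{A} \subseteq 2^\omega$ such that (a) if $X \in \mathcal{A}$ and $Y \supseteq X$ then $Y \in \mathcal{A}$, and (b) for every $k$ and every sets $Y_0, \dots, Y_{k-1}$ with $Y_0 \cup \dots \cup Y_{k-1} \supseteq \omega$, there is some $j < k$ with $Y_j \in \mathcal{A}$. -}

module Defs where

open import Data.Nat using (ℕ; _≤_)
open import Data.Bool using (Bool; true)
open import Data.Fin using (Fin)
open import Data.Product using (Σ; _×_)
open import Relation.Binary.PropositionalEquality using (_≡_)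

-- Subsets of ω identified with elements of 2^ω.
Cantor : Set
Cantor = ℕ → Bool

Class : Set₁
Class = Cantor → Set

_⊆ω_ : Cantor → Cantor → Set
X ⊆ω Y = ∀ n → X n ≡ true → Y n ≡ true

Covers : ∀ {k} → (Fin k → Cantor) → Set
Covers {k} Y = ∀ n → Σ (Fin k) λ j → Y j n ≡ true

record IsLargeness (𝒜 : Class) : Set where
  field
    nonempty     : Σ Cantor 𝒜
    upward       : ∀ X Y → 𝒜 X → X ⊆ω Y → 𝒜 Y
    partitionReg : ∀ (k : ℕ) (Y : Fin k → Cantor) → Covers Y → Σ (Fin k) λ j → 𝒜 (Y j)

_⊇c_ : Class → Class → Set
𝒜 ⊇c ℬ = ∀ X → ℬ X → 𝒜 X

⋂ : (ℕ → Class) → Class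
⋂ 𝒜 X = ∀ s → 𝒜 s X

-- By partition regularity, each A_s contains ω, so the intersection is non-empty, and it is
-- clearly upward closed. Given a finite cover Y₀, …, Y_{k-1}, suppose no Y_j lies in every
-- A_s. Classically each Y_j then leaves the sequence at some stage s_j, and since the A_s
-- decrease, the stage S = max_j s_j contains none of the Y_j, contradicting the partition
-- regularity of A_S.
module Submission where

open import Defs
open import Data.Nat using (ℕ; zero; suc; _≤_; _≤′_; ≤′-reflexive; ≤′-step; _⊔_)
open import Data.Nat.Properties using (≤⇒≤′; m≤m⊔n; m≤n⊔m)
open import Level using (0ℓ)
open import Axiom.ExcludedMiddle using (ExcludedMiddle)
open import Data.Fin using (Fin; zero; suc)
open import Data.Bool using (true)
open import Data.Product using (Σ; ∃; _,_)
open import Data.Sum using (_⊎_; inj₁; inj₂)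
open import Data.Empty using (⊥-elim)
open import Relation.Nullary using (¬_; yes; no)
open import Relation.Nullary.Decidable using (decidable-stable)
open import Relation.Binary.PropositionalEquality using (refl)

Antitone : (ℕ → Set) → Set
Antitone P = ∀ {s t} → s ≤ t → P t → P s

decreasing⇒antitone : (𝒜 : ℕ → Class) → (∀ s → 𝒜 s ⊇c 𝒜 (suc s)) →
                      ∀ X → Antitone (λ s → 𝒜 s X)
decreasing⇒antitone 𝒜 D X s≤t = go (≤⇒≤′ s≤t)
  where
    go : ∀ {s t} → s ≤′ t → 𝒜 t X → 𝒜 s X
    go (≤′-reflexive refl) a = a
    go (≤′-step s≤′t)      a = go s≤′t (D _ X a)

module _ (em : ExcludedMiddle 0ℓ) where

  ∀⊎∃¬ : (P : ℕ → Set) → (∀ s → P s) ⊎ ∃ λ s → ¬ P s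
  ∀⊎∃¬ P with em {∃ λ s → ¬ P s}
  ... | yes counterexample = inj₂ counterexample
  ... | no  ∄¬P            = inj₁ λ s → decidable-stable em λ ¬Ps → ∄¬P (s , ¬Ps)

  some-always⊎all-fail-eventually : ∀ k (P : Fin k → ℕ → Set) → (∀ j → Antitone (P j)) →
    (Σ (Fin k) λ j → ∀ s → P j s) ⊎ (Σ ℕ λ S → ∀ j → ¬ P j S)
  some-always⊎all-fail-eventually zero    P antitone = inj₂ (0 , λ ())
  some-always⊎all-fail-eventually (suc k) P antitone with ∀⊎∃¬ (P zero)
  ... | inj₁ always = inj₁ (zero , always)
  ... | inj₂ (s₀ , ¬P₀) with some-always⊎all-fail-eventually k (λ j → P (suc j)) (λ j → antitone (suc j))
  ...   | inj₁ (j , always) = inj₁ (suc j , always)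
  ...   | inj₂ (S , ¬Pₛ)    = inj₂ (s₀ ⊔ S , fails)
    where
      fails : ∀ j → ¬ P j (s₀ ⊔ S)
      fails zero    p = ¬P₀ (antitone zero (m≤m⊔n s₀ S) p)
      fails (suc j) p = ¬Pₛ j (antitone (suc j) (m≤n⊔m s₀ S) p)

ω : Cantor
ω _ = true

large⇒ω∈ : ∀ {𝒜} → IsLargeness 𝒜 → 𝒜 ω
large⇒ω∈ L with IsLargeness.partitionReg L 1 (λ _ → ω) (λ _ → zero , refl)
... | zero , 𝒜ω = 𝒜ω

lemma2p2 : ExcludedMiddle 0ℓ → (𝒜 : ℕ → Class) →
    (∀ s → IsLargeness (𝒜 s)) → (∀ s → 𝒜 s ⊇c 𝒜 (suc s)) →
    IsLargeness (⋂ 𝒜)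
lemma2p2 em 𝒜 L D = record
  { nonempty     = ω , λ s → large⇒ω∈ (L s)
  ; upward       = λ X Y X∈ X⊆Y s → IsLargeness.upward (L s) X Y (X∈ s) X⊆Y
  ; partitionReg = partitionReg
  }
  where
    partitionReg : ∀ k (Y : Fin k → Cantor) → Covers Y → Σ (Fin k) λ j → ⋂ 𝒜 (Y j)
    partitionReg k Y cover
      with some-always⊎all-fail-eventually em k (λ j s → 𝒜 s (Y j))
                                           (λ j → decreasing⇒antitone 𝒜 D (Y j))
    ... | inj₁ found   = found
    ... | inj₂ (S , ¬𝒜ₛ) with IsLargeness.partitionReg (L S) k Y cover
    ...   | j , 𝒜ₛYⱼ = ⊥-elim (¬𝒜ₛ j 𝒜ₛYⱼ)
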